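{- Let $\mathcal{P}$ be a type-C poset of height one. Then $RG(\mathcal{P})$ does not contain any of the following subgraphs (with vertex set $V$, dashed edge set $E_D$, non-dashed edge set $E_{\overline{D}}$): (a) $V=\{i,j\}$, $E_D=\{\{i,j\}\}$, $E_{\overline{D}}=\{\{j,j\}\}$ with $i>j$; (b) $V=\{i,j\}$, $E_D=\{\{i,j\}\}$, $E_{\overline{D}}=\{\{i,j\}\}$; (c) $V=\{i,j,k\}$, $E_D=\{\{i,j\}\}$, $E_{\overline{D}}=\{\{j,k\}\}$ with $i>j$; (d) $V=\{i,j,k\}$, $E_D=\{\{i,j\},\{j,k\}\}$ with $i>j>k$ or $i<j<k$.
   Context: A type-C poset is a partial order $\preceq$ on $\mathcal{P}=\{ -n,\dots,-1,1,\dots,n\}$ ($n\ge 1$) such that (1) $i\preceq j$ implies $i\le j$ as integers, and (2) whenever $i\neq -j$, $i\preceq j$ if and only if $-j\preceq -i$. Write $i\prec j$ for $i\preceq j$, $i\ne j$. The poset has height one if every chain has cardinality at most two. The relation graph $RG(\mathcal{P})$ has vertex set $\{1,\dots,n\}$; for positive $i,j$ with $-i\prec j$ there is a (non-dashed) edge $\{i,j\}$ (a self-loop when $i=j$), and for positive $i\neq j$ with $-i\prec -j$ there is a dashed edge $\{i,j\}$. Vertices $i,j,k$ in the listed subgraphs are distinct positive integers. -}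

module Defs where

open import Data.Nat using (ℕ; suc)
open import Data.Fin using (Fin; toℕ; _<_)
open import Data.Integer using (ℤ; +_; -_) renaming (_≤_ to _≤ℤ_)
open import Data.Product using (_×_; Σ; ∃; ∃-syntax; _,_)
open import Data.Sum using (_⊎_)
open import Relation.Nullary using (¬_)
open import Relation.Binary.PropositionalEquality using (_≡_; _≢_)
open import Relation.Binary.Structures using (IsPartialOrder)
open import Function.Bundles using (_⇔_)

-- The ground set P = {-n,…,-1,1,…,n}: pos i stands for the integer (toℕ i + 1),
-- neg i for its negative -(toℕ i + 1).
data El (n : ℕ) : Set where
  pos : Fin n → El n
  neg : Fin n → El n

val : ∀ {n} → El n → ℤ
val (pos i) = + suc (toℕ i)
val (neg i) = - (+ suc (toℕ i))

negate : ∀ {n} → El n → El n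
negate (pos i) = neg i
negate (neg i) = pos i

record TypeCPoset (n : ℕ) : Set₁ where
  field
    _≼_ : El n → El n → Set
    isPartialOrder : IsPartialOrder _≡_ _≼_
    compatible : ∀ {x y} → x ≼ y → val x ≤ℤ val y
    symmetric : ∀ x y → x ≢ negate y → (x ≼ y) ⇔ (negate y ≼ negate x)

  _≺_ : El n → El n → Set
  x ≺ y = (x ≼ y) × (x ≢ y)

open TypeCPoset public

HeightOne : ∀ {n} → TypeCPoset n → Set
HeightOne P = ∀ a b c → ¬ ((_≺_ P a b) × (_≺_ P b c))

-- Relation graph RG(P) on vertex set {1,…,n} (vertex i ↔ pos i).
-- Non-dashed edge {i,j} (self-loop if i = j): -i ≺ j (or, as an unordered edge, -j ≺ i).
Edge : ∀ {n} → TypeCPoset n → Fin n → Fin n → Set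
Edge P i j = _≺_ P (neg i) (pos j) ⊎ _≺_ P (neg j) (pos i)

Dashed : ∀ {n} → TypeCPoset n → Fin n → Fin n → Set
Dashed P i j = (i ≢ j) × (_≺_ P (neg i) (neg j) ⊎ _≺_ P (neg j) (neg i))

-- Forbidden subgraphs (vertices distinct; order on positive integers = order on Fin)
SubA : ∀ {n} → TypeCPoset n → Set
SubA {n} P = ∃[ i ] ∃[ j ] (i ≢ j × j < i × Dashed P i j × Edge P j j)

SubB : ∀ {n} → TypeCPoset n → Set
SubB {n} P = ∃[ i ] ∃[ j ] (i ≢ j × Dashed P i j × Edge P i j)

SubC : ∀ {n} → TypeCPoset n → Set
SubC {n} P = ∃[ i ] ∃[ j ] ∃[ k ]
  (i ≢ j × j ≢ k × i ≢ k × j < i × Dashed P i j × Edge P j k)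

SubD : ∀ {n} → TypeCPoset n → Set
SubD {n} P = ∃[ i ] ∃[ j ] ∃[ k ]
  (i ≢ j × j ≢ k × i ≢ k × ((j < i × k < j) ⊎ (i < j × j < k))
   × Dashed P i j × Dashed P j k)

-- In a type-C poset -x ≼ -y forces x ≥ y, so a dashed edge {i,j} with j < i can
-- only be the relation -i ≺ -j. Each forbidden subgraph then yields a chain of
-- three elements: (a) -i ≺ -j ≺ j, (b) -i ≺ -j ≺ i or -j ≺ -i ≺ j,
-- (c) -i ≺ -j ≺ k, (d) -i ≺ -j ≺ -k or -k ≺ -j ≺ -i.
module Submission where

open import Defs
open import Data.Nat using (ℕ; _≥_)
open import Data.Nat.Properties using (<⇒≱)
open import Data.Fin using (Fin; _≤_; _<_)
open import Data.Integer using (-≤-)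
open import Data.Product using (_×_; _,_)
open import Data.Sum using (inj₁; inj₂; swap)
open import Relation.Nullary using (¬_)
open import Relation.Binary.PropositionalEquality using (_≢_; refl; ≢-sym)
open import Function.Bundles using (Equivalence)

module _ {n : ℕ} (P : TypeCPoset n) where

  neg≼neg⇒≥ : ∀ {i j : Fin n} → _≼_ P (neg i) (neg j) → j ≤ i
  neg≼neg⇒≥ le with compatible P le
  ... | -≤- j≤i = j≤i

  Dashed-sym : ∀ {i j} → Dashed P i j → Dashed P j i
  Dashed-sym (i≢j , r) = ≢-sym i≢j , swap r

  Dashed⇒neg≺neg : ∀ {i j} → j < i → Dashed P i j → _≺_ P (neg i) (neg j)
  Dashed⇒neg≺neg j<i (_ , inj₁ ≺ij) = ≺ij
  Dashed⇒neg≺neg j<i (_ , inj₂ (≼ji , _)) with () ← <⇒≱ j<i (neg≼neg⇒≥ ≼ji)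

  neg≺pos-flip : ∀ {i j} → i ≢ j → _≺_ P (neg i) (pos j) → _≺_ P (neg j) (pos i)
  neg≺pos-flip {i} {j} i≢j (≼ij , _) =
    Equivalence.to (symmetric P (neg i) (pos j) neg≢neg) ≼ij , λ ()
    where
    neg≢neg : neg i ≢ neg j
    neg≢neg refl = i≢j refl

  Edge⇒neg≺pos : ∀ {i j} → i ≢ j → Edge P i j → _≺_ P (neg i) (pos j)
  Edge⇒neg≺pos i≢j (inj₁ ≺ij) = ≺ij
  Edge⇒neg≺pos i≢j (inj₂ ≺ji) = neg≺pos-flip (≢-sym i≢j) ≺ji

  loop⇒neg≺pos : ∀ {i} → Edge P i i → _≺_ P (neg i) (pos i)
  loop⇒neg≺pos (inj₁ ≺ii) = ≺ii
  loop⇒neg≺pos (inj₂ ≺ii) = ≺ii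

mainTheorem16 : (n : ℕ) → n ≥ 1 → (P : TypeCPoset n) → HeightOne P →
    ¬ SubA P × ¬ SubB P × ¬ SubC P × ¬ SubD P
mainTheorem16 n _ P noChain = noA , noB , noC , noD
  where
  noA : ¬ SubA P
  noA (i , j , _ , j<i , D , E) =
    noChain _ _ _ (Dashed⇒neg≺neg P j<i D , loop⇒neg≺pos P E)

  noB : ¬ SubB P
  noB (i , j , i≢j , (_ , inj₁ ≺ij) , E) =
    noChain _ _ _ (≺ij , Edge⇒neg≺pos P (≢-sym i≢j) (swap E))
  noB (i , j , i≢j , (_ , inj₂ ≺ji) , E) =
    noChain _ _ _ (≺ji , Edge⇒neg≺pos P i≢j E)

  noC : ¬ SubC P
  noC (i , j , k , _ , j≢k , _ , j<i , D , E) =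
    noChain _ _ _ (Dashed⇒neg≺neg P j<i D , Edge⇒neg≺pos P j≢k E)

  noD : ¬ SubD P
  noD (i , j , k , _ , _ , _ , inj₁ (j<i , k<j) , Dij , Djk) =
    noChain _ _ _ (Dashed⇒neg≺neg P j<i Dij , Dashed⇒neg≺neg P k<j Djk)
  noD (i , j , k , _ , _ , _ , inj₂ (i<j , j<k) , Dij , Djk) =
    noChain _ _ _ ( Dashed⇒neg≺neg P j<k (Dashed-sym P Djk)
                  , Dashed⇒neg≺neg P i<j (Dashed-sym P Dij))
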